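{- Let $P=P_1\oplus P_2\oplus\cdots\oplus P_k$ be the linear sum of finite nonempty ordered sets $P_1,\dots,P_k$. Then $|\mathcal{G}(P)|=\prod_{i=1}^{k}|\mathcal{G}(P_i)|$.
   Context: The linear sum $P_1\oplus\cdots\oplus P_k$ of pairwise disjoint ordered sets is the ordered set on the union of their ground sets where $x\le y$ iff either $x,y$ lie in the same $P_i$ and $x\le y$ there, or $x\in P_i$, $y\in P_j$ with $i<j$. For a finite ordered set $Q$, $U(x)=\{v: x<v\}$, and a linear extension $L=x_1<\cdots<x_n$ of $Q$ is greedy if: $x_1$ is minimal in $Q$; having chosen $x_1,\dots,x_i$, if no element of $U(x_i)$ is minimal in $Q\setminus\{x_1,\dots,x_i\}$ (in particular if $U(x_i)=\varnothing$), then $x_{i+1}$ is any minimal element of $Q\setminus\{x_1,\dots,x_i\}$; otherwise $x_{i+1}$ is an element of $U(x_i)$ minimal in $Q\setminus\{x_1,\dots,x_i\}$. $\mathcal{G}(Q)$ denotes the set of greedy linear extensions of $Q$. -}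

module Defs where

open import Data.Nat using (ℕ; zero; suc; _*_)
open import Data.Fin using (Fin)
import Data.Fin as F
open import Data.Fin.Properties using () renaming (_≟_ to _≟F_)
open import Data.Bool using (Bool; true; false; _∧_; _∨_; not; if_then_else_)
open import Data.List using (List; []; _∷_; length; filterᵇ; concatMap; map; allFin)
open import Data.Bool.ListAction using (any)
open import Data.Maybe using (Maybe; just; nothing)
open import Data.Product using (Σ; _,_)
open import Data.Product.Properties using (≡-dec)
open import Relation.Binary using (Rel; Decidable; IsPartialOrder)
open import Relation.Binary.PropositionalEquality using (_≡_; refl)
open import Relation.Binary.Definitions using (DecidableEquality)
open import Relation.Nullary using (does; yes; no)
open import Data.List.Membership.Propositional using (_∈_)
open import Data.List.Relation.Unary.Unique.Propositional using (Unique)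

record FinOrd : Set₁ where
  field
    Carrier : Set
    _≤_     : Carrier → Carrier → Set
    _≤?_    : Decidable _≤_
    _≟_     : DecidableEquality Carrier
    elems   : List Carrier

open FinOrd public

record IsFinPoset (Q : FinOrd) : Set where
  field
    isPartialOrder : IsPartialOrder _≡_ (_≤_ Q)
    complete       : ∀ x → x ∈ elems Q
    unique         : Unique (elems Q)

module _ (Q : FinOrd) where
  private
    C = Carrier Q

  lt : C → C → Bool
  lt x y = does ((_≤?_ Q) x y) ∧ not (does ((_≟_ Q) x y))

  mem : C → List C → Bool
  mem x = any (λ y → does ((_≟_ Q) x y))

  remove : C → List C → List C
  remove x [] = []
  remove x (y ∷ ys) = if does ((_≟_ Q) x y) then ys else y ∷ remove x ys

  minimalIn : C → List C → Bool
  minimalIn x R = mem x R ∧ not (any (λ y → lt y x) R)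

  -- greedyFrom prev R L : the sequence L, chosen after the previously chosen
  -- element prev from the remaining set R, follows the greedy rule and
  -- exhausts R.  Each chosen element must be minimal in the remaining set
  -- (so L is a linear extension); if some element of U(prev) is minimal in
  -- the remaining set, the chosen element must lie in U(prev).
  greedyFrom : Maybe C → List C → List C → Bool
  greedyFrom prev R [] with R
  ... | []    = true
  ... | _ ∷ _ = false
  greedyFrom prev R (x ∷ L) =
    minimalIn x R ∧ forced prev ∧ greedyFrom (just x) (remove x R) L
    where
    forced : Maybe C → Bool
    forced nothing  = true
    forced (just p) = not (any (λ u → lt p u ∧ minimalIn u R) R) ∨ lt p x

  isGreedy : List C → Bool
  isGreedy L = greedyFrom nothing (elems Q) L

  listsOfLength : ℕ → List C → List (List C)
  listsOfLength zero    xs = [] ∷ []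
  listsOfLength (suc m) xs =
    concatMap (λ x → map (x ∷_) (listsOfLength m xs)) xs

  numGreedy : ℕ
  numGreedy = length (filterᵇ isGreedy (listsOfLength (length (elems Q)) (elems Q)))

module _ {k : ℕ} (P : Fin k → FinOrd) where
  SumCarrier : Set
  SumCarrier = Σ (Fin k) (λ i → Carrier (P i))

  data SumLe : SumCarrier → SumCarrier → Set where
    same : ∀ {i x y} → _≤_ (P i) x y → SumLe (i , x) (i , y)
    less : ∀ {i j x y} → i F.< j → SumLe (i , x) (j , y)

  sumLe? : Decidable SumLe
  sumLe? (i , x) (j , y) with i F.<? j
  ... | yes i<j = yes (less i<j)
  ... | no i≮j with i ≟F j
  ...   | no i≢j = no λ { (same _) → i≢j refl ; (less i<j) → i≮j i<j }
  ...   | yes refl with (_≤?_ (P i)) x y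
  ...     | yes x≤y = yes (same x≤y)
  ...     | no x≰y = no λ { (same x≤y) → x≰y x≤y ; (less i<j) → i≮j i<j }

  linearSum : FinOrd
  linearSum = record
    { Carrier = SumCarrier
    ; _≤_     = SumLe
    ; _≤?_    = sumLe?
    ; _≟_     = ≡-dec _≟F_ (λ {i} → _≟_ (P i))
    ; elems   = concatMap (λ i → map (i ,_) (elems (P i))) (allFin k)
    }

prodFin : (k : ℕ) → (Fin k → ℕ) → ℕ
prodFin zero    f = 1
prodFin (suc k) f = f F.zero * prodFin k (λ i → f (F.suc i))

module Submission where

-- Write P = P₀ ⊕ P' with P' = P₁ ⊕ ⋯ ⊕ P_{k-1}.  A greedy linear extension of P
-- must list all of P₀ first (no element of P' is minimal while part of P₀
-- remains), and on that prefix the greedy rule of P coincides with that of P₀.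
-- When P₀ is exhausted, every minimal element of P' lies above the last chosen
-- element, so the greedy rule imposes no constraint at the junction, and from then
-- on it coincides with the greedy rule of P'.  Hence |G(P)| = |G(P₀)|·|G(P')|,
-- and the theorem follows by induction on k.

open import Defs
open import Data.Nat using (ℕ; zero; suc; pred; _+_; _*_; s≤s; z≤n)
open import Data.Nat.Properties using (*-identityˡ; *-distribʳ-+; +-identityʳ)
open import Data.Nat.ListAction using (sum)
open import Data.Nat.ListAction.Properties using (sum-++)
open import Data.Bool using (Bool; true; false; _∧_; _∨_; not; if_then_else_; T?)
open import Data.Bool.Properties using (∧-assoc; ∨-assoc; ∨-identityʳ; ∨-zeroʳ; ∧-zeroʳ)
open import Data.Bool.ListAction using (any; or)
open import Data.List using (List; []; _∷_; _++_; length; null; filterᵇ; concatMap; map; tabulate; allFin)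
open import Data.List.Properties
  using (map-∘; map-++; map-cong; length-++; length-map; filter-++; concatMap-cong; concatMap-map;
         map-concatMap; map-tabulate)
open import Data.Maybe using (Maybe; just; nothing)
import Data.Maybe as Maybe
open import Data.Fin using (Fin)
import Data.Fin as Fin
open import Data.Product using (_,_)
open import Function using (_∘_; mk⇔)
open import Relation.Nullary using (does)
open import Relation.Nullary.Decidable using (does-⇔; dec-true; dec-false)
open import Relation.Binary.PropositionalEquality
  using (_≡_; refl; sym; trans; cong; cong₂; module ≡-Reasoning)
open ≡-Reasoning

module _ {A : Set} where

  any-++ : ∀ (f : A → Bool) xs ys → any f (xs ++ ys) ≡ any f xs ∨ any f ys
  any-++ f []       ys = refl
  any-++ f (x ∷ xs) ys = trans (cong (f x ∨_) (any-++ f xs ys)) (sym (∨-assoc (f x) _ _))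

  any-cong : ∀ {f g : A → Bool} → (∀ x → f x ≡ g x) → ∀ xs → any f xs ≡ any g xs
  any-cong f≗g xs = cong or (map-cong f≗g xs)

  any-false : ∀ (f : A → Bool) → (∀ x → f x ≡ false) → ∀ xs → any f xs ≡ false
  any-false f f≡false []       = refl
  any-false f f≡false (x ∷ xs) rewrite f≡false x = any-false f f≡false xs

  sum-cong : ∀ {f g : A → ℕ} → (∀ x → f x ≡ g x) →
    ∀ xs → sum (map f xs) ≡ sum (map g xs)
  sum-cong f≗g xs = cong sum (map-cong f≗g xs)

  sum-guarded-zero : ∀ (g : A → Bool) (f : A → ℕ) → (∀ x → g x ≡ false) →
    ∀ xs → sum (map (λ x → if g x then f x else 0) xs) ≡ 0
  sum-guarded-zero g f g≡false []       = refl
  sum-guarded-zero g f g≡false (x ∷ xs) rewrite g≡false x = sum-guarded-zero g f g≡false xs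

  sum-*ʳ : ∀ (f : A → ℕ) c xs → sum (map (λ x → f x * c) xs) ≡ sum (map f xs) * c
  sum-*ʳ f c []       = refl
  sum-*ʳ f c (x ∷ xs) = begin
    f x * c + sum (map (λ x → f x * c) xs) ≡⟨ cong (f x * c +_) (sum-*ʳ f c xs) ⟩
    f x * c + sum (map f xs) * c           ≡⟨ sym (*-distribʳ-+ c (f x) _) ⟩
    (f x + sum (map f xs)) * c             ∎

  length-filterᵇ-concatMap : ∀ {B : Set} (p : B → Bool) (f : A → List B) xs →
    length (filterᵇ p (concatMap f xs)) ≡ sum (map (λ x → length (filterᵇ p (f x))) xs)
  length-filterᵇ-concatMap p f []       = refl
  length-filterᵇ-concatMap p f (x ∷ xs) = begin
    length (filterᵇ p (f x ++ concatMap f xs))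
      ≡⟨ cong length (filter-++ (T? ∘ p) (f x) (concatMap f xs)) ⟩
    length (filterᵇ p (f x) ++ filterᵇ p (concatMap f xs))
      ≡⟨ length-++ (filterᵇ p (f x)) ⟩
    length (filterᵇ p (f x)) + length (filterᵇ p (concatMap f xs))
      ≡⟨ cong (length (filterᵇ p (f x)) +_) (length-filterᵇ-concatMap p f xs) ⟩
    sum (map (λ x → length (filterᵇ p (f x))) (x ∷ xs)) ∎

  length-filterᵇ-prefix : ∀ (p q : List A → Bool) x b → (∀ L → p (x ∷ L) ≡ b ∧ q L) →
    ∀ Ls → length (filterᵇ p (map (x ∷_) Ls)) ≡ (if b then length (filterᵇ q Ls) else 0)
  length-filterᵇ-prefix p q x true  p≡q     = accepted
    where
    accepted : ∀ Ls → length (filterᵇ p (map (x ∷_) Ls)) ≡ length (filterᵇ q Ls)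
    accepted []       = refl
    accepted (L ∷ Ls) rewrite p≡q L with q L
    ... | true  = cong suc (accepted Ls)
    ... | false = accepted Ls
  length-filterᵇ-prefix p q x false p≡false = rejected
    where
    rejected : ∀ Ls → length (filterᵇ p (map (x ∷_) Ls)) ≡ 0
    rejected []       = refl
    rejected (L ∷ Ls) rewrite p≡false L = rejected Ls

module _ (Q : FinOrd) where
  private
    C : Set
    C = Carrier Q

  followsGreedyRule : Maybe C → List C → C → Bool
  followsGreedyRule nothing  R x = true
  followsGreedyRule (just p) R x = not (any (λ u → lt Q p u ∧ minimalIn Q u R) R) ∨ lt Q p x

  admissible : Maybe C → List C → C → Bool
  admissible prev R x = minimalIn Q x R ∧ followsGreedyRule prev R x

  -- the number of ways to complete a greedy extension in m more steps, choosing
  -- among the candidates E, after prev and with R remaining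
  countFrom : List C → Maybe C → List C → ℕ → ℕ
  countFrom E prev R zero    = if null R then 1 else 0
  countFrom E prev R (suc m) =
    sum (map (λ x → if admissible prev R x then countFrom E (just x) (remove Q x R) m else 0) E)

  greedyFrom-∷ : ∀ prev R x L →
    greedyFrom Q prev R (x ∷ L) ≡ admissible prev R x ∧ greedyFrom Q (just x) (remove Q x R) L
  greedyFrom-∷ nothing  R x L = sym (∧-assoc (minimalIn Q x R) true _)
  greedyFrom-∷ (just p) R x L = sym (∧-assoc (minimalIn Q x R) _ _)

  countFrom-correct : ∀ E m prev R →
    length (filterᵇ (greedyFrom Q prev R) (listsOfLength Q m E)) ≡ countFrom E prev R m
  countFrom-correct E zero    prev []      = refl
  countFrom-correct E zero    prev (_ ∷ _) = refl
  countFrom-correct E (suc m) prev R =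
    trans (length-filterᵇ-concatMap (greedyFrom Q prev R) (λ x → map (x ∷_) (listsOfLength Q m E)) E)
          (sum-cong firstChoice E)
    where
    firstChoice : ∀ x →
      length (filterᵇ (greedyFrom Q prev R) (map (x ∷_) (listsOfLength Q m E)))
        ≡ (if admissible prev R x then countFrom E (just x) (remove Q x R) m else 0)
    firstChoice x =
      trans (length-filterᵇ-prefix (greedyFrom Q prev R) (greedyFrom Q (just x) (remove Q x R))
                                   x (admissible prev R x) (greedyFrom-∷ prev R x)
                                   (listsOfLength Q m E))
            (cong (if admissible prev R x then_else 0) (countFrom-correct E m (just x) (remove Q x R)))

  numGreedy≡countFrom : numGreedy Q ≡ countFrom (elems Q) nothing (elems Q) (length (elems Q))
  numGreedy≡countFrom = countFrom-correct (elems Q) (length (elems Q)) nothing (elems Q)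

  admissible⇒mem : ∀ prev R x → admissible prev R x ≡ true → mem Q x R ≡ true
  admissible⇒mem prev R x adm with mem Q x R
  ... | true  = refl
  ... | false = adm

  length-remove : ∀ x R → mem Q x R ≡ true → suc (length (remove Q x R)) ≡ length R
  length-remove x (y ∷ R) x∈R with does ((_≟_ Q) x y)
  ... | true  = refl
  ... | false = cong suc (length-remove x R x∈R)

module _ {k : ℕ} (P : Fin (suc k) → FinOrd) where
  private
    Head Tail Sum : FinOrd
    Head = P Fin.zero
    Tail = linearSum (P ∘ Fin.suc)
    Sum  = linearSum P

  inl : Carrier Head → Carrier Sum
  inl a = (Fin.zero , a)

  inr : Carrier Tail → Carrier Sum
  inr (i , y) = (Fin.suc i , y)

  mixed : List (Carrier Head) → List (Carrier Tail) → List (Carrier Sum)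
  mixed R₀ R' = map inl R₀ ++ map inr R'

  any-mixed : ∀ (f : Carrier Sum → Bool) R₀ R' →
    any f (mixed R₀ R') ≡ any (f ∘ inl) R₀ ∨ any (f ∘ inr) R'
  any-mixed f R₀ R' = begin
    any f (map inl R₀ ++ map inr R')             ≡⟨ any-++ f (map inl R₀) (map inr R') ⟩
    any f (map inl R₀) ∨ any f (map inr R')      ≡⟨ cong₂ _∨_ (cong or (sym (map-∘ R₀)))
                                                              (cong or (sym (map-∘ R'))) ⟩
    any (f ∘ inl) R₀ ∨ any (f ∘ inr) R'          ∎

  sum-mixed : ∀ (f : Carrier Sum → ℕ) E₀ E' →
    sum (map f (mixed E₀ E')) ≡ sum (map (f ∘ inl) E₀) + sum (map (f ∘ inr) E')
  sum-mixed f E₀ E' = begin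
    sum (map f (map inl E₀ ++ map inr E'))       ≡⟨ cong sum (map-++ f (map inl E₀) (map inr E')) ⟩
    sum (map f (map inl E₀) ++ map f (map inr E')) ≡⟨ sum-++ (map f (map inl E₀)) _ ⟩
    sum (map f (map inl E₀)) + sum (map f (map inr E'))
      ≡⟨ cong₂ _+_ (cong sum (sym (map-∘ E₀))) (cong sum (sym (map-∘ E'))) ⟩
    sum (map (f ∘ inl) E₀) + sum (map (f ∘ inr) E') ∎

  elems-split : elems Sum ≡ mixed (elems Head) (elems Tail)
  elems-split = cong (map inl (elems Head) ++_) (begin
    concatMap block (tabulate Fin.suc)
      ≡⟨ cong (concatMap block) (sym (map-tabulate (λ i → i) Fin.suc)) ⟩
    concatMap block (map Fin.suc (allFin k))
      ≡⟨ concatMap-map block Fin.suc (allFin k) ⟩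
    concatMap (block ∘ Fin.suc) (allFin k)
      ≡⟨ concatMap-cong (λ i → map-∘ (elems (P (Fin.suc i)))) (allFin k) ⟩
    concatMap (map inr ∘ tailBlock) (allFin k)
      ≡⟨ sym (map-concatMap inr tailBlock (allFin k)) ⟩
    map inr (concatMap tailBlock (allFin k)) ∎)
    where
    block : (i : Fin (suc k)) → List (Carrier Sum)
    block i = map (i ,_) (elems (P i))
    tailBlock : (i : Fin k) → List (Carrier Tail)
    tailBlock i = map (i ,_) (elems (P (Fin.suc i)))

  length-mixed : ∀ R₀ R' → length (mixed R₀ R') ≡ length R₀ + length R'
  length-mixed R₀ R' =
    trans (length-++ (map inl R₀)) (cong₂ _+_ (length-map inl R₀) (length-map inr R'))

  ≟-inl : ∀ a b → does ((_≟_ Sum) (inl a) (inl b)) ≡ does ((_≟_ Head) a b)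
  ≟-inl a b = does-⇔ (mk⇔ (λ { refl → refl }) (λ { refl → refl }))
    ((_≟_ Sum) (inl a) (inl b)) ((_≟_ Head) a b)

  ≟-inl-inr : ∀ a v → does ((_≟_ Sum) (inl a) (inr v)) ≡ false
  ≟-inl-inr a (i , y) = dec-false ((_≟_ Sum) (inl a) (Fin.suc i , y)) (λ ())

  ≟-inr : ∀ u v → does ((_≟_ Sum) (inr u) (inr v)) ≡ does ((_≟_ Tail) u v)
  ≟-inr u@(i , x) v@(j , y) = does-⇔ (mk⇔ (λ { refl → refl }) (λ { refl → refl }))
    ((_≟_ Sum) (inr u) (inr v)) ((_≟_ Tail) u v)

  ≤-inl : ∀ a b → does ((_≤?_ Sum) (inl a) (inl b)) ≡ does ((_≤?_ Head) a b)
  ≤-inl a b = does-⇔ (mk⇔ (λ { (same a≤b) → a≤b ; (less ()) }) same)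
    ((_≤?_ Sum) (inl a) (inl b)) ((_≤?_ Head) a b)

  ≤-inl-inr : ∀ a v → does ((_≤?_ Sum) (inl a) (inr v)) ≡ true
  ≤-inl-inr a (i , y) = dec-true ((_≤?_ Sum) (inl a) (Fin.suc i , y)) (less (s≤s z≤n))

  ≤-inr-inl : ∀ v a → does ((_≤?_ Sum) (inr v) (inl a)) ≡ false
  ≤-inr-inl (i , y) a = dec-false ((_≤?_ Sum) (Fin.suc i , y) (inl a)) (λ { (less ()) })

  ≤-inr : ∀ u v → does ((_≤?_ Sum) (inr u) (inr v)) ≡ does ((_≤?_ Tail) u v)
  ≤-inr u@(i , x) v@(j , y) = does-⇔
    (mk⇔ (λ { (same x≤y) → same x≤y ; (less (s≤s i<j)) → less i<j })
         (λ { (same x≤y) → same x≤y ; (less i<j) → less (s≤s i<j) }))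
    ((_≤?_ Sum) (inr u) (inr v)) ((_≤?_ Tail) u v)

  lt-inl : ∀ a b → lt Sum (inl a) (inl b) ≡ lt Head a b
  lt-inl a b = cong₂ (λ le eq → le ∧ not eq) (≤-inl a b) (≟-inl a b)

  lt-inl-inr : ∀ a v → lt Sum (inl a) (inr v) ≡ true
  lt-inl-inr a v rewrite ≤-inl-inr a v | ≟-inl-inr a v = refl

  lt-inr-inl : ∀ v a → lt Sum (inr v) (inl a) ≡ false
  lt-inr-inl v a rewrite ≤-inr-inl v a = refl

  lt-inr : ∀ u v → lt Sum (inr u) (inr v) ≡ lt Tail u v
  lt-inr u v = cong₂ (λ le eq → le ∧ not eq) (≤-inr u v) (≟-inr u v)

  mem-inl : ∀ a R₀ R' → mem Sum (inl a) (mixed R₀ R') ≡ mem Head a R₀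
  mem-inl a R₀ R' = begin
    mem Sum (inl a) (mixed R₀ R')
      ≡⟨ any-mixed _ R₀ R' ⟩
    any (λ b → does ((_≟_ Sum) (inl a) (inl b))) R₀ ∨ any (λ v → does ((_≟_ Sum) (inl a) (inr v))) R'
      ≡⟨ cong₂ _∨_ (any-cong (≟-inl a) R₀) (any-false _ (≟-inl-inr a) R') ⟩
    mem Head a R₀ ∨ false
      ≡⟨ ∨-identityʳ _ ⟩
    mem Head a R₀ ∎

  mem-inr : ∀ u R' → mem Sum (inr u) (map inr R') ≡ mem Tail u R'
  mem-inr u R' = trans (any-mixed _ [] R') (any-cong (≟-inr u) R')

  minimal-inl : ∀ a R₀ R' → minimalIn Sum (inl a) (mixed R₀ R') ≡ minimalIn Head a R₀
  minimal-inl a R₀ R' = cong₂ (λ m b → m ∧ not b) (mem-inl a R₀ R') (begin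
    any (λ y → lt Sum y (inl a)) (mixed R₀ R')
      ≡⟨ any-mixed _ R₀ R' ⟩
    any (λ b → lt Sum (inl b) (inl a)) R₀ ∨ any (λ v → lt Sum (inr v) (inl a)) R'
      ≡⟨ cong₂ _∨_ (any-cong (λ b → lt-inl b a) R₀) (any-false _ (λ v → lt-inr-inl v a) R') ⟩
    any (λ b → lt Head b a) R₀ ∨ false
      ≡⟨ ∨-identityʳ _ ⟩
    any (λ b → lt Head b a) R₀ ∎)

  minimal-inr-blocked : ∀ v r R₀ R' → minimalIn Sum (inr v) (mixed (r ∷ R₀) R') ≡ false
  minimal-inr-blocked v r R₀ R' rewrite lt-inl-inr r v = ∧-zeroʳ _

  minimal-inr : ∀ u R' → minimalIn Sum (inr u) (map inr R') ≡ minimalIn Tail u R'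
  minimal-inr u R' = cong₂ (λ m b → m ∧ not b) (mem-inr u R')
    (trans (any-mixed _ [] R') (any-cong (λ v → lt-inr v u) R'))

  remove-inl : ∀ a R₀ R' → remove Sum (inl a) (mixed R₀ R') ≡ mixed (remove Head a R₀) R'
  remove-inl a []       R' = absent R'
    where
    absent : ∀ R' → remove Sum (inl a) (map inr R') ≡ map inr R'
    absent []       = refl
    absent (v ∷ R') rewrite ≟-inl-inr a v = cong (inr v ∷_) (absent R')
  remove-inl a (b ∷ R₀) R' rewrite ≟-inl a b with does ((_≟_ Head) a b)
  ... | true  = refl
  ... | false = cong (inl b ∷_) (remove-inl a R₀ R')

  remove-inr : ∀ u R' → remove Sum (inr u) (map inr R') ≡ map inr (remove Tail u R')
  remove-inr u []       = refl
  remove-inr u (v ∷ R') rewrite ≟-inr u v with does ((_≟_ Tail) u v)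
  ... | true  = refl
  ... | false = cong (inr v ∷_) (remove-inr u R')

  admissible-inl : ∀ prev a r R₀ R' →
    admissible Sum (Maybe.map inl prev) (mixed (r ∷ R₀) R') (inl a) ≡ admissible Head prev (r ∷ R₀) a
  admissible-inl prev a r R₀ R' = cong₂ _∧_ (minimal-inl a (r ∷ R₀) R') (rule prev)
    where
    R : List (Carrier Head)
    R = r ∷ R₀
    rule : ∀ prev → followsGreedyRule Sum (Maybe.map inl prev) (mixed R R') (inl a)
                      ≡ followsGreedyRule Head prev R a
    rule nothing  = refl
    rule (just p) = cong₂ (λ blocked above → not blocked ∨ above) (begin
      any (λ u → lt Sum (inl p) u ∧ minimalIn Sum u (mixed R R')) (mixed R R')
        ≡⟨ any-mixed _ R R' ⟩
      any (λ b → lt Sum (inl p) (inl b) ∧ minimalIn Sum (inl b) (mixed R R')) R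
        ∨ any (λ v → lt Sum (inl p) (inr v) ∧ minimalIn Sum (inr v) (mixed R R')) R'
        ≡⟨ cong₂ _∨_ (any-cong (λ b → cong₂ _∧_ (lt-inl p b) (minimal-inl b R R')) R)
                     (any-false (λ v → lt Sum (inl p) (inr v) ∧ minimalIn Sum (inr v) (mixed R R'))
                                (λ v → trans (cong (lt Sum (inl p) (inr v) ∧_) (minimal-inr-blocked v r R₀ R'))
                                             (∧-zeroʳ (lt Sum (inl p) (inr v)))) R') ⟩
      any (λ b → lt Head p b ∧ minimalIn Head b R) R ∨ false
        ≡⟨ ∨-identityʳ _ ⟩
      any (λ b → lt Head p b ∧ minimalIn Head b R) R ∎) (lt-inl p a)

  admissible-inr-blocked : ∀ prev v r R₀ R' → admissible Sum prev (mixed (r ∷ R₀) R') (inr v) ≡ false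
  admissible-inr-blocked prev v r R₀ R' rewrite minimal-inr-blocked v r R₀ R' = refl

  admissible-inl-exhausted : ∀ prev a R' → admissible Sum prev (map inr R') (inl a) ≡ false
  admissible-inl-exhausted prev a R' rewrite minimal-inl a [] R' = refl

  -- at the junction, the last element of P₀ lies below everything remaining, so
  -- the greedy rule is vacuous
  admissible-junction : ∀ p R' x →
    admissible Sum (just (inl p)) (map inr R') x ≡ admissible Sum nothing (map inr R') x
  admissible-junction p R' (Fin.zero  , a) rewrite minimal-inl a [] R' = refl
  admissible-junction p R' (Fin.suc i , y) rewrite lt-inl-inr p (i , y) =
    cong (minimalIn Sum (Fin.suc i , y) (map inr R') ∧_)
         (∨-zeroʳ (not (any (λ u → lt Sum (inl p) u ∧ minimalIn Sum u (map inr R')) (map inr R'))))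

  admissible-inr : ∀ prev u R' →
    admissible Sum (Maybe.map inr prev) (map inr R') (inr u) ≡ admissible Tail prev R' u
  admissible-inr nothing  u R' = cong (_∧ true) (minimal-inr u R')
  admissible-inr (just p) u R' = cong₂ _∧_ (minimal-inr u R')
    (cong₂ (λ blocked above → not blocked ∨ above)
      (trans (any-mixed _ [] R')
             (any-cong (λ v → cong₂ _∧_ (lt-inr p v) (minimal-inr v R')) R'))
      (lt-inr p u))

  module Counting (E₀ : List (Carrier Head)) (E' : List (Carrier Tail)) where
    E : List (Carrier Sum)
    E = mixed E₀ E'

    countJunction : ∀ p R' m →
      countFrom Sum E (just (inl p)) (map inr R') m ≡ countFrom Sum E nothing (map inr R') m
    countJunction p R' zero    = refl
    countJunction p R' (suc m) =
      sum-cong (λ x → cong (λ b → if b then countFrom Sum E (just x) (remove Sum x (map inr R')) m else 0)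
                           (admissible-junction p R' x)) E

    countTail : ∀ m prev R' →
      countFrom Sum E (Maybe.map inr prev) (map inr R') m ≡ countFrom Tail E' prev R' m
    countTail zero    prev []      = refl
    countTail zero    prev (_ ∷ _) = refl
    countTail (suc m) prev R' =
      trans (sum-mixed _ E₀ E')
            (cong₂ _+_ (sum-guarded-zero
                         (λ a → admissible Sum (Maybe.map inr prev) (map inr R') (inl a))
                         (λ a → countFrom Sum E (just (inl a)) (remove Sum (inl a) (map inr R')) m)
                         (λ a → admissible-inl-exhausted (Maybe.map inr prev) a R') E₀)
                       (sum-cong tailStep E'))
      where
      tailStep : ∀ u →
        (if admissible Sum (Maybe.map inr prev) (map inr R') (inr u)
         then countFrom Sum E (just (inr u)) (remove Sum (inr u) (map inr R')) m else 0)
        ≡ (if admissible Tail prev R' u then countFrom Tail E' (just u) (remove Tail u R') m else 0)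
      tailStep u rewrite admissible-inr prev u R' | remove-inr u R' =
        cong (if admissible Tail prev R' u then_else 0) (countTail m (just u) (remove Tail u R'))

    countHead : ∀ R₀ m₀ → length R₀ ≡ m₀ → ∀ prev R' m' →
      countFrom Sum E (Maybe.map inl prev) (mixed R₀ R') (m₀ + m')
        ≡ countFrom Head E₀ prev R₀ m₀ * countFrom Sum E nothing (map inr R') m'
    countHead []       zero     _   nothing  R' m' = sym (*-identityˡ _)
    countHead []       zero     _   (just p) R' m' = trans (countJunction p R' m') (sym (*-identityˡ _))
    countHead (r ∷ R₀) (suc m₀) len prev     R' m' = begin
      sum (map step E)
        ≡⟨ sum-mixed step E₀ E' ⟩
      sum (map (step ∘ inl) E₀) + sum (map (step ∘ inr) E')
        ≡⟨ cong₂ _+_ (sum-cong headStep E₀)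
                     (sum-guarded-zero
                       (λ v → admissible Sum (Maybe.map inl prev) R (inr v))
                       (λ v → countFrom Sum E (just (inr v)) (remove Sum (inr v) R) (m₀ + m'))
                       (λ v → admissible-inr-blocked (Maybe.map inl prev) v r R₀ R') E') ⟩
      sum (map (λ a → choice a * rest) E₀) + 0
        ≡⟨ +-identityʳ _ ⟩
      sum (map (λ a → choice a * rest) E₀)
        ≡⟨ sum-*ʳ choice rest E₀ ⟩
      countFrom Head E₀ prev (r ∷ R₀) (suc m₀) * rest ∎
      where
      R : List (Carrier Sum)
      R = mixed (r ∷ R₀) R'
      rest : ℕ
      rest = countFrom Sum E nothing (map inr R') m'
      step : Carrier Sum → ℕ
      step x = if admissible Sum (Maybe.map inl prev) R x
               then countFrom Sum E (just x) (remove Sum x R) (m₀ + m') else 0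
      choice : Carrier Head → ℕ
      choice a = if admissible Head prev (r ∷ R₀) a
                 then countFrom Head E₀ (just a) (remove Head a (r ∷ R₀)) m₀ else 0
      headStep : ∀ a → step (inl a) ≡ choice a * rest
      headStep a rewrite admissible-inl prev a r R₀ R' | remove-inl a (r ∷ R₀) R'
        with admissible Head prev (r ∷ R₀) a in adm
      ... | true  = countHead (remove Head a (r ∷ R₀)) m₀ shorter (just a) R' m'
        where
        shorter : length (remove Head a (r ∷ R₀)) ≡ m₀
        shorter = cong pred
          (trans (length-remove Head a (r ∷ R₀) (admissible⇒mem Head prev (r ∷ R₀) a adm)) len)
      ... | false = refl

  numGreedy-⊕ : numGreedy Sum ≡ numGreedy Head * numGreedy Tail
  numGreedy-⊕ = begin
    numGreedy Sum
      ≡⟨ numGreedy≡countFrom Sum ⟩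
    countFrom Sum (elems Sum) nothing (elems Sum) (length (elems Sum))
      ≡⟨ cong (λ L → countFrom Sum L nothing L (length L)) elems-split ⟩
    countFrom Sum E nothing E (length E)
      ≡⟨ cong (countFrom Sum E nothing E) (length-mixed E₀ E') ⟩
    countFrom Sum E nothing E (length E₀ + length E')
      ≡⟨ countHead E₀ (length E₀) refl nothing E' (length E') ⟩
    countFrom Head E₀ nothing E₀ (length E₀) * countFrom Sum E nothing (map inr E') (length E')
      ≡⟨ cong₂ _*_ (sym (numGreedy≡countFrom Head))
                   (trans (countTail (length E') nothing E') (sym (numGreedy≡countFrom Tail))) ⟩
    numGreedy Head * numGreedy Tail ∎
    where
    E₀ : List (Carrier Head)
    E₀ = elems Head
    E' : List (Carrier Tail)
    E' = elems Tail
    open Counting E₀ E'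

numGreedy-linearSum : ∀ k (P : Fin k → FinOrd) → numGreedy (linearSum P) ≡ prodFin k (numGreedy ∘ P)
numGreedy-linearSum zero    P = refl
numGreedy-linearSum (suc k) P =
  trans (numGreedy-⊕ P) (cong (numGreedy (P Fin.zero) *_) (numGreedy-linearSum k (P ∘ Fin.suc)))

mainTheorem3 : (k : ℕ) (P : Fin k → FinOrd)
    → (∀ i → IsFinPoset (P i))
    → (∀ i → Carrier (P i))
    → numGreedy (linearSum P) ≡ prodFin k (λ i → numGreedy (P i))
mainTheorem3 k P _ _ = numGreedy-linearSum k P
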